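{- Let $\alpha:V\to K$ be an injective $\mathbb{F}_q$-linear map and let $W\subset V$ be an $\mathbb{F}_q$-subspace. Then the map $V\to K$ sending $v$ to $\binom{\alpha}{\mathbf{1}_{v+W}}$ if $v\notin W$ and to $0$ if $v\in W$ is $\mathbb{F}_q$-linear.
   Context: $V$ is a finite-dimensional vector space over the finite field $\mathbb{F}_q$ and $K$ is a field containing $\mathbb{F}_q$, with perfect closure $K_{\mathrm{perf}}$. For an injective $\mathbb{F}_q$-linear $\alpha:V\to K$ and a function $\Phi:V\to\mathbb{Z}[1/q]$, the toy Catalan symbol is $\binom{\alpha}{\Phi}=\prod_{0\ne v\in V}\alpha(v)^{\Phi(v)}\in K_{\mathrm{perf}}^\times$. $\mathbf{1}_S$ is the indicator function of $S$. -}

module Defs where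

open import Level using (0ℓ)
open import Data.Nat using (ℕ; zero; suc)
open import Data.List using (List; []; _∷_; foldr; map; concatMap)
open import Data.List.Membership.Propositional using (_∈_)
open import Data.List.Relation.Unary.Unique.Propositional using (Unique)
open import Data.Vec using (Vec; []; _∷_; replicate; zipWith)
import Data.Vec as Vec
open import Data.Vec.Properties using (≡-dec)
open import Data.Product using (∃; _×_)
open import Relation.Nullary using (¬_; Dec; yes; no)
open import Relation.Binary.PropositionalEquality using (_≡_)
open import Algebra.Structures using (IsCommutativeRing)

record Field : Set₁ where
  infixl 6 _+_
  infixl 7 _*_
  field
    Carrier : Set
    _+_ _*_ : Carrier → Carrier → Carrier
    -_ : Carrier → Carrier
    0# 1# : Carrier
    isCommutativeRing : IsCommutativeRing _≡_ _+_ _*_ -_ 0# 1#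
    0≢1 : ¬ (0# ≡ 1#)
    inverse : ∀ x → ¬ (x ≡ 0#) → ∃ λ y → x * y ≡ 1#

  _-_ : Carrier → Carrier → Carrier
  x - y = x + (- y)

  _^_ : Carrier → ℕ → Carrier
  x ^ zero = 1#
  x ^ suc n = x * (x ^ n)

  prod : List Carrier → Carrier
  prod = foldr _*_ 1#

-- A finite field F_q: a field with decidable equality and a complete,
-- duplicate-free enumeration of its elements (q = length of the list).
record FiniteField : Set₁ where
  field
    field' : Field
  open Field field' public
  field
    _≟_ : (x y : Carrier) → Dec (x ≡ y)
    elements : List Carrier
    complete : ∀ x → x ∈ elements
    unique : Unique elements

record Extension (F : FiniteField) (K : Field) : Set where
  private
    module F = FiniteField F
    module K = Field K
  field
    ι : F.Carrier → K.Carrier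
    ι-+ : ∀ x y → ι (x F.+ y) ≡ ι x K.+ ι y
    ι-* : ∀ x y → ι (x F.* y) ≡ ι x K.* ι y
    ι-1 : ι F.1# ≡ K.1#

-- The vector space V = F_q^n (every finite-dimensional F_q-space is
-- isomorphic to one of these).
module VectorSpace (F : FiniteField) (n : ℕ) where
  open FiniteField F

  V : Set
  V = Vec Carrier n

  _⊕_ : V → V → V
  _⊕_ = zipWith _+_

  _⊖_ : V → V → V
  _⊖_ = zipWith _-_

  _·_ : Carrier → V → V
  c · v = Vec.map (c *_) v

  𝟎 : V
  𝟎 = replicate n 0#

  _≟V_ : (u v : V) → Dec (u ≡ v)
  _≟V_ = ≡-dec _≟_

  allVecs : (m : ℕ) → List (Vec Carrier m)
  allVecs zero = [] ∷ []
  allVecs (suc m) = concatMap (λ x → map (x ∷_) (allVecs m)) elements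

  record Subspace : Set₁ where
    field
      _∈W : V → Set
      dec : ∀ v → Dec (v ∈W)
      zero∈ : 𝟎 ∈W
      +-closed : ∀ u v → u ∈W → v ∈W → (u ⊕ v) ∈W
      ·-closed : ∀ c v → v ∈W → (c · v) ∈W

  𝟏coset : Subspace → V → V → ℕ
  𝟏coset W v u with Subspace.dec W (u ⊖ v)
  ... | yes _ = 1
  ... | no _ = 0

  module _ (K : Field) (E : Extension F K) where
    private module K = Field K
    open Extension E

    IsLinear : (V → K.Carrier) → Set
    IsLinear f = (∀ u v → f (u ⊕ v) ≡ f u K.+ f v)
               × (∀ c v → f (c · v) ≡ ι c K.* f v)

    IsInjective : (V → K.Carrier) → Set
    IsInjective f = ∀ u v → f u ≡ f v → u ≡ v

    -- Toy Catalan symbol (α choose Φ) = ∏_{0 ≠ v ∈ V} α(v)^{Φ(v)},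
    -- for ℕ-valued Φ (then it lies in K ⊆ K_perf).
    catalan : (V → K.Carrier) → (V → ℕ) → K.Carrier
    catalan α Φ = K.prod (map factor (allVecs n))
      where
      factor : V → K.Carrier
      factor v with v ≟V 𝟎
      ... | yes _ = K.1#
      ... | no _ = α v K.^ Φ v

    cosetMap : (V → K.Carrier) → Subspace → V → K.Carrier
    cosetMap α W v with Subspace.dec W v
    ... | yes _ = K.0#
    ... | no _ = catalan α (𝟏coset W v)

{-# OPTIONS --safe #-}
module Submission where

-- Write G(X) = ∏_{w ∈ W} (X + α w) for the subspace polynomial of α(W).  For v ∉ W the
-- coset v + W avoids 0 and is enumerated by w ↦ v + w, so the Catalan symbol of 1_{v+W} is
-- G(α v); for v ∈ W both sides vanish because G is zero on α(W).  It remains to see that G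
-- is F_q-linear on K.  Additivity: for fixed y, G(x + y) − (G x + G y) has degree < |W| in x
-- and vanishes at the |W| distinct points α(W), since G is invariant under translation by
-- α(W).  Homogeneity: G(X) = X · P(X) with P(X) = ∏_{0 ≠ w ∈ W} (X + α w); substituting
-- c w for w shows P(c X) = c^{|W|-1} P(X), and at X = 0, where P does not vanish, this
-- forces c^{|W|-1} = 1.

open import Defs
open import Level using (0ℓ)
open import Data.Nat using (ℕ; zero; suc; _≤_; s≤s)
open import Data.Nat.Properties using (≤-reflexive)
open import Data.Product using (Σ; ∃; _×_; _,_; proj₁; proj₂)
open import Data.Bool using (true; false; if_then_else_)
open import Data.List using (List; []; _∷_; map; length; filter; concatMap; cartesianProductWith; _++_)
open import Data.List.Properties using (map-∘; map-cong; length-map)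
open import Data.List.Relation.Unary.All as All using (All; []; _∷_)
import Data.List.Relation.Unary.All.Properties as Allₚ
open import Data.List.Relation.Unary.Any using (here; there)
open import Data.List.Relation.Unary.Unique.Propositional using (Unique; []; _∷_)
import Data.List.Relation.Unary.Unique.Propositional.Properties as Unique
open import Data.List.Membership.Propositional using (_∈_)
open import Data.List.Membership.Propositional.Properties using (∈-map⁻; ∈-map⁺; ∈-filter⁺; ∈-filter⁻; ∈-cartesianProductWith⁺)
open import Data.List.Membership.Propositional.Properties.WithK using (unique∧set⇒bag)
open import Data.List.Relation.Binary.BagAndSetEquality using (∼bag⇒↭)
open import Data.List.Relation.Binary.Permutation.Propositional using (_↭_; ↭⇒↭ₛ)
import Data.List.Relation.Binary.Permutation.Propositional.Properties as ↭
import Data.List.Relation.Binary.Permutation.Setoid.Properties as ↭ₛ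
open import Data.Vec using (Vec; []; _∷_; zipWith; replicate)
import Data.Vec as Vec
import Data.Vec.Properties as Vecₚ
open import Function using (_∘_; _⇔_; mk⇔; Equivalence)
import Function.Properties.Equivalence as ⇔
open import Relation.Nullary using (¬_; yes; no; does; ¬?; _×-dec_; contradiction)
open import Relation.Unary using (Decidable)
open import Relation.Binary.Definitions using (DecidableEquality)
open import Relation.Binary.PropositionalEquality
open import Algebra.Bundles using (CommutativeRing)
import Algebra.Properties.Ring
import Algebra.Properties.Group
import Algebra.Properties.AbelianGroup
import Algebra.Solver.Ring.NaturalCoefficients.Default as NatSolver

module FieldProperties (K : Field) where
  open Field K

  commutativeRing : CommutativeRing 0ℓ 0ℓ
  commutativeRing = record
    { Carrier = Carrier ; _≈_ = _≡_ ; _+_ = _+_ ; _*_ = _*_ ; -_ = -_ ; 0# = 0# ; 1# = 1#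
    ; isCommutativeRing = isCommutativeRing }

  open CommutativeRing commutativeRing public
    using ( +-assoc; +-comm; +-identityˡ; +-identityʳ; *-assoc; *-comm; *-identityˡ; *-identityʳ
          ; -‿inverseʳ; zeroˡ; zeroʳ; distribˡ; *-isCommutativeMonoid )
  open Algebra.Properties.Ring (CommutativeRing.ring commutativeRing) public using (-1*x≈-x)
  open Algebra.Properties.Group (CommutativeRing.+-group commutativeRing) public
    using (x∙y⁻¹≈ε⇒x≈y; identityʳ-unique; //-rightDividesˡ; //-rightDividesʳ)
  open Algebra.Properties.AbelianGroup (CommutativeRing.+-abelianGroup commutativeRing) public
    using (⁻¹-anti-homo‿-; ⁻¹-∙-comm)
  open NatSolver (CommutativeRing.commutativeSemiring commutativeRing) public
    using (solve; _:=_; _:+_; _:*_)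

  x*0+y≡y : ∀ x y → x * 0# + y ≡ y
  x*0+y≡y x y = trans (cong (_+ y) (zeroʳ x)) (+-identityˡ y)

  x-[x-y]≡y : ∀ x y → x - (x - y) ≡ y
  x-[x-y]≡y x y = begin
    x + - (x - y)  ≡⟨ cong (x +_) (⁻¹-anti-homo‿- x y) ⟩
    x + (y - x)    ≡⟨ +-comm x (y - x) ⟩
    (y - x) + x    ≡⟨ //-rightDividesˡ x y ⟩
    y              ∎
    where open ≡-Reasoning

  [x+y]-[x+z]≡y-z : ∀ x y z → (x + y) - (x + z) ≡ y - z
  [x+y]-[x+z]≡y-z x y z = begin
    (x + y) + - (x + z)      ≡⟨ cong ((x + y) +_) (sym (⁻¹-∙-comm x z)) ⟩
    (x + y) + (- x + - z)    ≡⟨ solve 4 (λ x y x′ z′ → (x :+ y) :+ (x′ :+ z′) := (x :+ x′) :+ (y :+ z′)) refl x y (- x) (- z) ⟩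
    (x - x) + (y - z)        ≡⟨ cong (_+ (y - z)) (-‿inverseʳ x) ⟩
    0# + (y - z)             ≡⟨ +-identityˡ (y - z) ⟩
    y - z                    ∎
    where open ≡-Reasoning

  x≢y⇒x-y≢0 : ∀ {x y} → x ≢ y → x - y ≢ 0#
  x≢y⇒x-y≢0 x≢y = x≢y ∘ x∙y⁻¹≈ε⇒x≈y _ _

  x*y≡y⇒x≡1 : ∀ {x y} → y ≢ 0# → x * y ≡ y → x ≡ 1#
  x*y≡y⇒x≡1 {x} {y} y≢0 xy≡y with inverse y y≢0
  ... | y⁻¹ , yy⁻¹≡1 = begin
    x                ≡⟨ sym (*-identityʳ x) ⟩
    x * 1#           ≡⟨ cong (x *_) (sym yy⁻¹≡1) ⟩
    x * (y * y⁻¹)    ≡⟨ sym (*-assoc x y y⁻¹) ⟩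
    (x * y) * y⁻¹    ≡⟨ cong (_* y⁻¹) xy≡y ⟩
    y * y⁻¹          ≡⟨ yy⁻¹≡1 ⟩
    1#               ∎
    where open ≡-Reasoning

  x*y≡0⇒y≡0 : ∀ {x y} → x ≢ 0# → x * y ≡ 0# → y ≡ 0#
  x*y≡0⇒y≡0 {x} {y} x≢0 xy≡0 with inverse x x≢0
  ... | x⁻¹ , xx⁻¹≡1 = begin
    y                ≡⟨ sym (*-identityˡ y) ⟩
    1# * y           ≡⟨ cong (_* y) (sym xx⁻¹≡1) ⟩
    (x * x⁻¹) * y    ≡⟨ solve 3 (λ x x⁻¹ y → (x :* x⁻¹) :* y := x⁻¹ :* (x :* y)) refl x x⁻¹ y ⟩
    x⁻¹ * (x * y)    ≡⟨ cong (x⁻¹ *_) xy≡0 ⟩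
    x⁻¹ * 0#         ≡⟨ zeroʳ x⁻¹ ⟩
    0#               ∎
    where open ≡-Reasoning

  *-≢0 : ∀ {x y} → x ≢ 0# → y ≢ 0# → x * y ≢ 0#
  *-≢0 x≢0 y≢0 = y≢0 ∘ x*y≡0⇒y≡0 x≢0

module Products (K : Field) where
  open Field K
  open FieldProperties K

  prod-↭ : ∀ {xs ys} → xs ↭ ys → prod xs ≡ prod ys
  prod-↭ = ↭ₛ.foldr-commMonoid (setoid Carrier) *-isCommutativeMonoid ∘ ↭⇒↭ₛ

  prod-map-↭ : ∀ {A B : Set} (h : B → Carrier) (σ : A → B) {xs ys} → map σ xs ↭ ys
             → prod (map (h ∘ σ) xs) ≡ prod (map h ys)
  prod-map-↭ h σ {xs} σxs↭ys = trans (cong prod (map-∘ xs)) (prod-↭ (↭.map⁺ h σxs↭ys))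

  prod-map-*ˡ : ∀ {A : Set} (a : Carrier) (f : A → Carrier) xs
              → prod (map (λ x → a * f x) xs) ≡ a ^ length xs * prod (map f xs)
  prod-map-*ˡ a f [] = sym (*-identityˡ 1#)
  prod-map-*ˡ a f (x ∷ xs) = begin
    a * f x * prod (map (λ x → a * f x) xs)   ≡⟨ cong (a * f x *_) (prod-map-*ˡ a f xs) ⟩
    a * f x * (a ^ length xs * prod (map f xs))
      ≡⟨ solve 4 (λ a b c d → a :* b :* (c :* d) := a :* c :* (b :* d)) refl a (f x) (a ^ length xs) _ ⟩
    a * a ^ length xs * (f x * prod (map f xs)) ∎
    where open ≡-Reasoning

  prod-map-filter : ∀ {A : Set} {P : A → Set} (P? : Decidable P) (f : A → Carrier) xs
                  → prod (map (λ x → if does (P? x) then f x else 1#) xs) ≡ prod (map f (filter P? xs))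
  prod-map-filter P? f [] = refl
  prod-map-filter P? f (x ∷ xs) with does (P? x)
  ... | true  = cong (f x *_) (prod-map-filter P? f xs)
  ... | false = trans (*-identityˡ _) (prod-map-filter P? f xs)

  prod-≢0 : ∀ {xs} → All (_≢ 0#) xs → prod xs ≢ 0#
  prod-≢0 []             = 0≢1 ∘ sym
  prod-≢0 (x≢0 ∷ xs≢0) = *-≢0 x≢0 (prod-≢0 xs≢0)

-- Poly m f: f is a polynomial function of degree < m, in Horner form.
module Polynomials (K : Field) where
  open Field K
  open FieldProperties K

  data Poly : ℕ → (Carrier → Carrier) → Set where
    vanishing : ∀ {f} → (∀ x → f x ≡ 0#) → Poly zero f
    horner    : ∀ {m f} (g : Carrier → Carrier) (c : Carrier) → Poly m g
              → (∀ x → f x ≡ x * g x + c) → Poly (suc m) f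

  poly-resp : ∀ {m f f′} → (∀ x → f x ≡ f′ x) → Poly m f → Poly m f′
  poly-resp f≡f′ (vanishing f≡0)     = vanishing (λ x → trans (sym (f≡f′ x)) (f≡0 x))
  poly-resp f≡f′ (horner g c pg f≡) = horner g c pg (λ x → trans (sym (f≡f′ x)) (f≡ x))

  poly-suc : ∀ {m f} → Poly m f → Poly (suc m) f
  poly-suc (vanishing f≡0) = horner (λ _ → 0#) 0# (vanishing (λ _ → refl)) (λ x → trans (f≡0 x) (sym (x*0+y≡y x 0#)))
  poly-suc (horner g c pg f≡) = horner g c (poly-suc pg) f≡

  poly-0 : ∀ m → Poly m (λ _ → 0#)
  poly-0 zero    = vanishing (λ _ → refl)
  poly-0 (suc m) = poly-suc (poly-0 m)

  poly-const : ∀ m c → Poly (suc m) (λ _ → c)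
  poly-const m c = horner (λ _ → 0#) c (poly-0 m) (λ x → sym (x*0+y≡y x c))

  poly-^ : ∀ m → Poly (suc m) (_^ m)
  poly-^ zero    = poly-const zero 1#
  poly-^ (suc m) = horner (_^ m) 0# (poly-^ m) (λ x → sym (+-identityʳ _))

  poly-+ : ∀ {m f f′} → Poly m f → Poly m f′ → Poly m (λ x → f x + f′ x)
  poly-+ (vanishing f≡0) (vanishing f′≡0) = vanishing (λ x → trans (cong₂ _+_ (f≡0 x) (f′≡0 x)) (+-identityʳ 0#))
  poly-+ (horner g c pg f≡) (horner g′ c′ pg′ f′≡) =
    horner (λ x → g x + g′ x) (c + c′) (poly-+ pg pg′) λ x → trans (cong₂ _+_ (f≡ x) (f′≡ x))
      (solve 5 (λ x a b c d → (x :* a :+ c) :+ (x :* b :+ d) := x :* (a :+ b) :+ (c :+ d)) refl x (g x) (g′ x) c c′)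

  poly-*ˡ : ∀ {m f} a → Poly m f → Poly m (λ x → a * f x)
  poly-*ˡ a (vanishing f≡0) = vanishing (λ x → trans (cong (a *_) (f≡0 x)) (zeroʳ a))
  poly-*ˡ a (horner g c pg f≡) =
    horner (λ x → a * g x) (a * c) (poly-*ˡ a pg) λ x → trans (cong (a *_) (f≡ x))
      (solve 4 (λ a x b c → a :* (x :* b :+ c) := x :* (a :* b) :+ a :* c) refl a x (g x) c)

  poly-factor : ∀ {m f} → Poly (suc m) f → ∀ r
              → ∃ λ h → Poly m h × (∀ x → f x ≡ (x - r) * h x + f r)
  poly-factor {zero} {f} (horner g c (vanishing g≡0) f≡) r = (λ _ → 0#) , vanishing (λ _ → refl) , λ x → begin
    f x                 ≡⟨ f≡ x ⟩
    x * g x + c         ≡⟨ cong (λ y → x * y + c) (g≡0 x) ⟩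
    x * 0# + c          ≡⟨ x*0+y≡y x c ⟩
    c                   ≡⟨ sym (x*0+y≡y r c) ⟩
    r * 0# + c          ≡⟨ cong (λ y → r * y + c) (sym (g≡0 r)) ⟩
    r * g r + c         ≡⟨ sym (f≡ r) ⟩
    f r                 ≡⟨ sym (x*0+y≡y (x - r) (f r)) ⟩
    (x - r) * 0# + f r  ∎
    where open ≡-Reasoning
  poly-factor {suc m} {f} (horner g c pg f≡) r with poly-factor pg r
  ... | h , ph , g≡ = (λ x → x * h x + g r) , horner h (g r) ph (λ _ → refl) , λ x → begin
    f x                                                   ≡⟨ f≡ x ⟩
    x * g x + c                                           ≡⟨ cong (λ y → x * y + c) (g≡ x) ⟩
    x * ((x - r) * h x + g r) + c
      ≡⟨ cong (λ y → y * ((x - r) * h x + g r) + c) (sym (//-rightDividesˡ r x)) ⟩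
    ((x - r) + r) * ((x - r) * h x + g r) + c
      ≡⟨ solve 5 (λ d r h s c → (d :+ r) :* (d :* h :+ s) :+ c := d :* ((d :+ r) :* h :+ s) :+ (r :* s :+ c))
                 refl (x - r) r (h x) (g r) c ⟩
    (x - r) * (((x - r) + r) * h x + g r) + (r * g r + c)
      ≡⟨ cong₂ (λ y z → (x - r) * (y * h x + g r) + z) (//-rightDividesˡ r x) (sym (f≡ r)) ⟩
    (x - r) * (x * h x + g r) + f r                       ∎
    where open ≡-Reasoning

  poly-roots⇒≡0 : ∀ {m f} → Poly m f → (rs : List Carrier) → Unique rs → m ≤ length rs
                → All (λ r → f r ≡ 0#) rs → ∀ x → f x ≡ 0#
  poly-roots⇒≡0 (vanishing f≡0) _ _ _ _ = f≡0
  poly-roots⇒≡0 {f = f} pf@(horner _ _ _ _) (r ∷ rs) (r∉rs ∷ !rs) (s≤s m≤) (fr≡0 ∷ frs≡0) x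
    with poly-factor pf r
  ... | h , ph , f≡ = begin
    f x                  ≡⟨ f≡ x ⟩
    (x - r) * h x + f r  ≡⟨ cong₂ (λ y z → (x - r) * y + z) (h≡0 x) fr≡0 ⟩
    (x - r) * 0# + 0#    ≡⟨ x*0+y≡y (x - r) 0# ⟩
    0#                   ∎
    where
    open ≡-Reasoning
    root-of-h : ∀ {s} → r ≢ s × f s ≡ 0# → h s ≡ 0#
    root-of-h {s} (r≢s , fs≡0) = x*y≡0⇒y≡0 (x≢y⇒x-y≢0 (r≢s ∘ sym)) (begin
      (s - r) * h s        ≡⟨ sym (+-identityʳ _) ⟩
      (s - r) * h s + 0#   ≡⟨ cong ((s - r) * h s +_) (sym fr≡0) ⟩
      (s - r) * h s + f r  ≡⟨ sym (f≡ s) ⟩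
      f s                  ≡⟨ fs≡0 ⟩
      0#                   ∎)
    h≡0 : ∀ x → h x ≡ 0#
    h≡0 = poly-roots⇒≡0 ph rs !rs m≤ (All.zipWith root-of-h (r∉rs , frs≡0))

  Monic : ℕ → (Carrier → Carrier) → Set
  Monic m f = ∃ λ g → Poly m g × (∀ x → f x ≡ x ^ m + g x)

  monic-+-poly : ∀ {m f g} → Monic m f → Poly m g → Monic m (λ x → f x + g x)
  monic-+-poly {m} {g = g} (h , ph , f≡) pg =
    (λ x → h x + g x) , poly-+ ph pg , λ x → trans (cong (_+ g x) (f≡ x)) (+-assoc (x ^ m) (h x) (g x))

  monic-sub : ∀ {m f f′} → Monic m f → Monic m f′ → Poly m (λ x → f x - f′ x)
  monic-sub {m} {f} {f′} (g , pg , f≡) (g′ , pg′ , f′≡) = poly-resp difference (poly-+ pg (poly-*ˡ (- 1#) pg′))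
    where
    difference : ∀ x → g x + - 1# * g′ x ≡ f x - f′ x
    difference x = begin
      g x + - 1# * g′ x                  ≡⟨ cong (g x +_) (-1*x≈-x (g′ x)) ⟩
      g x - g′ x                         ≡⟨ sym ([x+y]-[x+z]≡y-z (x ^ m) (g x) (g′ x)) ⟩
      (x ^ m + g x) - (x ^ m + g′ x)     ≡⟨ cong₂ _-_ (f≡ x) (f′≡ x) ⟨
      f x - f′ x                         ∎
      where open ≡-Reasoning

  monic-linear-* : ∀ {m f} c → Monic m f → Monic (suc m) (λ x → (x + c) * f x)
  monic-linear-* {m} c (g , pg , f≡) =
    (λ x → x * g x + c * (x ^ m + g x)) ,
    poly-+ (horner g 0# pg (λ x → sym (+-identityʳ _))) (poly-*ˡ c (poly-+ (poly-^ m) (poly-suc pg))) ,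
    λ x → trans (cong ((x + c) *_) (f≡ x))
      (solve 4 (λ x c p q → (x :+ c) :* (p :+ q) := x :* p :+ (x :* q :+ c :* (p :+ q))) refl x c (x ^ m) (g x))

  monic-prod : ∀ {A : Set} (f : A → Carrier) ws → Monic (length ws) (λ x → prod (map (λ w → x + f w) ws))
  monic-prod f []       = (λ _ → 0#) , vanishing (λ _ → refl) , λ _ → sym (+-identityʳ 1#)
  monic-prod f (w ∷ ws) = monic-linear-* (f w) (monic-prod f ws)

  monic-resp : ∀ {m f f′} → (∀ x → f x ≡ f′ x) → Monic m f → Monic m f′
  monic-resp f≡f′ (g , pg , f≡) = g , pg , λ x → trans (sym (f≡f′ x)) (f≡ x)

record Enumerates {A : Set} (P : A → Set) (xs : List A) : Set where
  field
    unique : Unique xs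
    ∈⇔     : ∀ {x} → x ∈ xs ⇔ P x

module _ {A : Set} where
  open Enumerates
  open Equivalence

  enumerates-↭ : ∀ {P : A → Set} {xs ys} → Enumerates P xs → Enumerates P ys → xs ↭ ys
  enumerates-↭ exs eys = ∼bag⇒↭ (unique∧set⇒bag (unique exs) (unique eys) (⇔.trans (∈⇔ exs) (⇔.sym (∈⇔ eys))))

  enumerates-resp : ∀ {P Q : A → Set} {xs} → (∀ {x} → P x ⇔ Q x) → Enumerates P xs → Enumerates Q xs
  enumerates-resp P⇔Q exs = record { unique = unique exs ; ∈⇔ = ⇔.trans (∈⇔ exs) P⇔Q }

  enumerates-filter : ∀ {P : A → Set} {xs} → (∀ x → x ∈ xs) → Unique xs → (P? : Decidable P)
                    → Enumerates P (filter P? xs)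
  enumerates-filter {xs = xs} complete !xs P? = record
    { unique = Unique.filter⁺ P? !xs
    ; ∈⇔     = mk⇔ (proj₂ ∘ ∈-filter⁻ P? {xs = xs}) (∈-filter⁺ P? (complete _)) }

  enumerates-∷ : ∀ {P : A → Set} {a xs} → DecidableEquality A → P a
               → Enumerates (λ x → P x × x ≢ a) xs → Enumerates P (a ∷ xs)
  enumerates-∷ {P} {a} {xs} _≟_ Pa exs = record
    { unique = All.tabulate (λ x∈xs a≡x → proj₂ (to (∈⇔ exs) x∈xs) (sym a≡x)) ∷ unique exs
    ; ∈⇔     = mk⇔ to′ from′ }
    where
    to′ : ∀ {x} → x ∈ a ∷ xs → P x
    to′ (here refl)  = Pa
    to′ (there x∈xs) = proj₁ (to (∈⇔ exs) x∈xs)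
    from′ : ∀ {x} → P x → x ∈ a ∷ xs
    from′ {x} Px with x ≟ a
    ... | yes refl = here refl
    ... | no x≢a   = there (from (∈⇔ exs) (Px , x≢a))

  enumerates-map : ∀ {B : Set} {P : A → Set} {Q : B → Set} {xs} (σ : A → B)
                 → (∀ {x y} → σ x ≡ σ y → x ≡ y) → (∀ {x} → P x → Q (σ x))
                 → (∀ {y} → Q y → ∃ λ x → P x × σ x ≡ y)
                 → Enumerates P xs → Enumerates Q (map σ xs)
  enumerates-map {P = P} {Q} {xs} σ σ-injective P⇒Q Q⇒P exs = record
    { unique = Unique.map⁺ σ-injective (unique exs)
    ; ∈⇔     = mk⇔ to′ from′ }
    where
    to′ : ∀ {y} → y ∈ map σ xs → Q y
    to′ y∈ with ∈-map⁻ σ y∈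
    ... | x , x∈xs , refl = P⇒Q (to (∈⇔ exs) x∈xs)
    from′ : ∀ {y} → Q y → y ∈ map σ xs
    from′ Qy with Q⇒P Qy
    ... | x , Px , refl = ∈-map⁺ σ (from (∈⇔ exs) Px)

module VectorProperties (F : FiniteField) where
  open FiniteField F
  open FieldProperties field'

  ⊕-⊖-cancel : ∀ {k} (u w : Vec Carrier k) → zipWith _-_ (zipWith _+_ u w) w ≡ u
  ⊕-⊖-cancel []       []       = refl
  ⊕-⊖-cancel (a ∷ u) (b ∷ w) = cong₂ _∷_ (//-rightDividesʳ b a) (⊕-⊖-cancel u w)

  ⊖-⊕-cancel : ∀ {k} (u w : Vec Carrier k) → zipWith _+_ (zipWith _-_ u w) w ≡ u
  ⊖-⊕-cancel []       []       = refl
  ⊖-⊕-cancel (a ∷ u) (b ∷ w) = cong₂ _∷_ (//-rightDividesˡ b a) (⊖-⊕-cancel u w)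

  ⊖-⊖-cancel : ∀ {k} (u v : Vec Carrier k) → zipWith _-_ u (zipWith _-_ u v) ≡ v
  ⊖-⊖-cancel []       []       = refl
  ⊖-⊖-cancel (a ∷ u) (b ∷ v) = cong₂ _∷_ (x-[x-y]≡y a b) (⊖-⊖-cancel u v)

  ⊖≡⊕-1· : ∀ {k} (u w : Vec Carrier k) → zipWith _-_ u w ≡ zipWith _+_ u (Vec.map (- 1# *_) w)
  ⊖≡⊕-1· []       []       = refl
  ⊖≡⊕-1· (a ∷ u) (b ∷ w) = cong₂ _∷_ (cong (a +_) (sym (-1*x≈-x b))) (⊖≡⊕-1· u w)

  ·-inverse : ∀ {c c′} → c * c′ ≡ 1# → ∀ {k} (u : Vec Carrier k) → Vec.map (c′ *_) (Vec.map (c *_) u) ≡ u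
  ·-inverse {c} {c′} cc′≡1 u = begin
    Vec.map (c′ *_) (Vec.map (c *_) u)  ≡⟨ Vecₚ.map-∘ (c′ *_) (c *_) u ⟨
    Vec.map (λ a → c′ * (c * a)) u      ≡⟨ Vecₚ.map-cong c′[ca]≡a u ⟩
    Vec.map (λ a → a) u                 ≡⟨ Vecₚ.map-id u ⟩
    u                                   ∎
    where
    open ≡-Reasoning
    c′[ca]≡a : ∀ a → c′ * (c * a) ≡ a
    c′[ca]≡a a = trans (solve 3 (λ c c′ a → c′ :* (c :* a) := (c :* c′) :* a) refl c c′ a)
                       (trans (cong (_* a) cc′≡1) (*-identityˡ a))

  ·-𝟎 : ∀ c k → Vec.map (c *_) (replicate k 0#) ≡ replicate k 0#
  ·-𝟎 c k = trans (Vecₚ.map-replicate (c *_) 0# k) (cong (replicate k) (zeroʳ c))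

  𝟎⊕𝟎 : ∀ k → zipWith _+_ (replicate k 0#) (replicate k 0#) ≡ replicate k 0#
  𝟎⊕𝟎 k = trans (Vecₚ.zipWith-replicate _+_ 0# 0#) (cong (replicate k) (+-identityʳ 0#))

module VectorEnumeration (F : FiniteField) (n : ℕ) where
  open FiniteField F
  open VectorSpace F n

  allVecs-suc : ∀ {m} xs (vs : List (Vec Carrier m))
              → concatMap (λ x → map (x ∷_) vs) xs ≡ cartesianProductWith _∷_ xs vs
  allVecs-suc []       vs = refl
  allVecs-suc (x ∷ xs) vs = cong (map (x ∷_) vs ++_) (allVecs-suc xs vs)

  allVecs-complete : ∀ m (v : Vec Carrier m) → v ∈ allVecs m
  allVecs-complete zero    []      = here refl
  allVecs-complete (suc m) (x ∷ v) = subst ((x ∷ v) ∈_) (sym (allVecs-suc elements (allVecs m)))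
    (∈-cartesianProductWith⁺ _∷_ (complete x) (allVecs-complete m v))

  allVecs-unique : ∀ m → Unique (allVecs m)
  allVecs-unique zero    = [] ∷ []
  allVecs-unique (suc m) = subst Unique (sym (allVecs-suc elements (allVecs m)))
    (Unique.cartesianProductWith⁺ _∷_ Vecₚ.∷-injective unique (allVecs-unique m))

module SubspacePolynomial
  (F : FiniteField) (n : ℕ) (K : Field) (E : Extension F K)
  (α : VectorSpace.V F n → Field.Carrier K)
  (α-injective : VectorSpace.IsInjective F n K E α) (α-linear : VectorSpace.IsLinear F n K E α)
  (W : VectorSpace.Subspace F n)
  where

  open VectorSpace F n
  open Subspace W
  open Extension E
  open Field K
  open FieldProperties K
  open Products K
  open Polynomials K
  open VectorProperties F
  open VectorEnumeration F n
  open Enumerates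
  open Equivalence
  private module 𝔽 = FiniteField F

  α-additive : ∀ u v → α (u ⊕ v) ≡ α u + α v
  α-additive = proj₁ α-linear

  α-homogeneous : ∀ c v → α (c · v) ≡ ι c * α v
  α-homogeneous = proj₂ α-linear

  α-𝟎 : α 𝟎 ≡ 0#
  α-𝟎 = identityʳ-unique (α 𝟎) (α 𝟎) (trans (sym (α-additive 𝟎 𝟎)) (cong α (𝟎⊕𝟎 n)))

  α-≢0 : ∀ {v} → v ≢ 𝟎 → α v ≢ 0#
  α-≢0 {v} v≢𝟎 αv≡0 = v≢𝟎 (α-injective v 𝟎 (trans αv≡0 (sym α-𝟎)))

  ι-0 : ι 𝔽.0# ≡ 0#
  ι-0 = identityʳ-unique (ι 𝔽.0#) (ι 𝔽.0#)
    (trans (sym (ι-+ 𝔽.0# 𝔽.0#)) (cong ι (FieldProperties.+-identityʳ 𝔽.field' 𝔽.0#)))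

  ⊖-closed : ∀ {u w} → u ∈W → w ∈W → (u ⊖ w) ∈W
  ⊖-closed {u} {w} u∈W w∈W = subst _∈W (sym (⊖≡⊕-1· u w)) (+-closed u _ u∈W (·-closed (𝔽.- 𝔽.1#) w w∈W))

  L : List V
  L = allVecs n

  W* : List V
  W* = filter (λ w → dec w ×-dec ¬? (w ≟V 𝟎)) L

  W*-enumerates : Enumerates (λ w → w ∈W × w ≢ 𝟎) W*
  W*-enumerates = enumerates-filter (allVecs-complete n) (allVecs-unique n) _

  Ws : List V
  Ws = 𝟎 ∷ W*

  Ws-enumerates : Enumerates _∈W Ws
  Ws-enumerates = enumerates-∷ _≟V_ zero∈ W*-enumerates

  coset-enumerates : ∀ v → Enumerates (λ u → (u ⊖ v) ∈W) (map (_⊕ v) Ws)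
  coset-enumerates v = enumerates-map (_⊕ v) ⊕-injective
    (subst _∈W (sym (⊕-⊖-cancel _ v)))
    (λ {u} u-v∈W → u ⊖ v , u-v∈W , ⊖-⊕-cancel u v)
    Ws-enumerates
    where
    ⊕-injective : ∀ {u u′} → u ⊕ v ≡ u′ ⊕ v → u ≡ u′
    ⊕-injective {u} {u′} eq = trans (sym (⊕-⊖-cancel u v)) (trans (cong (_⊖ v) eq) (⊕-⊖-cancel u′ v))

  translate-↭ : ∀ {w} → w ∈W → map (_⊕ w) Ws ↭ Ws
  translate-↭ {w} w∈W = enumerates-↭ (enumerates-resp u-w∈W⇔u∈W (coset-enumerates w)) Ws-enumerates
    where
    u-w∈W⇔u∈W : ∀ {u} → (u ⊖ w) ∈W ⇔ u ∈W
    u-w∈W⇔u∈W {u} = mk⇔ (λ u-w∈W → subst _∈W (⊖-⊕-cancel u w) (+-closed _ w u-w∈W w∈W))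
                        (λ u∈W → ⊖-closed u∈W w∈W)

  scale-↭ : ∀ {c c′} → c 𝔽.* c′ ≡ 𝔽.1# → map (c ·_) W* ↭ W*
  scale-↭ {c} {c′} cc′≡1 = enumerates-↭ (enumerates-map (c ·_) ·-injective preserves reflects W*-enumerates) W*-enumerates
    where
    ·-injective : ∀ {u u′} → c · u ≡ c · u′ → u ≡ u′
    ·-injective {u} {u′} eq = trans (sym (·-inverse cc′≡1 u)) (trans (cong (c′ ·_) eq) (·-inverse cc′≡1 u′))
    preserves : ∀ {w} → w ∈W × w ≢ 𝟎 → (c · w) ∈W × (c · w) ≢ 𝟎
    preserves {w} (w∈W , w≢𝟎) = ·-closed c w w∈W ,
      λ cw≡𝟎 → w≢𝟎 (trans (sym (·-inverse cc′≡1 w)) (trans (cong (c′ ·_) cw≡𝟎) (·-𝟎 c′ n)))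
    reflects : ∀ {w} → w ∈W × w ≢ 𝟎 → ∃ λ u → (u ∈W × u ≢ 𝟎) × c · u ≡ w
    reflects {w} (w∈W , w≢𝟎) = c′ · w ,
      (·-closed c′ w w∈W , λ c′w≡𝟎 → w≢𝟎 (trans (sym (·-inverse c′c≡1 w)) (trans (cong (c ·_) c′w≡𝟎) (·-𝟎 c n)))) ,
      ·-inverse c′c≡1 w
      where
      c′c≡1 : c′ 𝔽.* c ≡ 𝔽.1#
      c′c≡1 = trans (FieldProperties.*-comm 𝔽.field' c′ c) cc′≡1

  G : Carrier → Carrier
  G x = prod (map (λ w → x + α w) Ws)

  P : Carrier → Carrier
  P x = prod (map (λ w → x + α w) W*)

  G≡x*P : ∀ x → G x ≡ x * P x
  G≡x*P x = cong (_* P x) (trans (cong (x +_) α-𝟎) (+-identityʳ x))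

  G-0 : G 0# ≡ 0#
  G-0 = trans (G≡x*P 0#) (zeroˡ (P 0#))

  G-translate : ∀ {w} → w ∈W → ∀ y → G (α w + y) ≡ G y
  G-translate {w} w∈W y = begin
    prod (map (λ u → (α w + y) + α u) Ws)         ≡⟨ cong prod (map-cong shift Ws) ⟩
    prod (map ((λ u → y + α u) ∘ (_⊕ w)) Ws)      ≡⟨ prod-map-↭ (λ u → y + α u) (_⊕ w) (translate-↭ w∈W) ⟩
    G y                                           ∎
    where
    open ≡-Reasoning
    shift : ∀ u → (α w + y) + α u ≡ y + α (u ⊕ w)
    shift u = trans (solve 3 (λ a y b → (a :+ y) :+ b := y :+ (b :+ a)) refl (α w) y (α u))
                    (cong (y +_) (sym (α-additive u w)))

  G-α-W : ∀ {w} → w ∈W → G (α w) ≡ 0#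
  G-α-W {w} w∈W = trans (cong G (sym (+-identityʳ (α w)))) (trans (G-translate w∈W 0#) G-0)

  G-additive : ∀ x y → G (x + y) ≡ G x + G y
  G-additive x y = x∙y⁻¹≈ε⇒x≈y _ _
    (poly-roots⇒≡0 D-poly (map α Ws) αWs-unique (≤-reflexive (sym (length-map α Ws))) D-roots x)
    where
    D : Carrier → Carrier
    D x = G (x + y) - (G x + G y)
    D-poly : Poly (length Ws) D
    D-poly = monic-sub
      (monic-resp (λ x → cong prod (map-cong (λ w → sym (+-assoc x y (α w))) Ws)) (monic-prod (λ w → y + α w) Ws))
      (monic-+-poly (monic-prod α Ws) (poly-const (length W*) (G y)))
    αWs-unique : Unique (map α Ws)
    αWs-unique = Unique.map⁺ (α-injective _ _) (unique Ws-enumerates)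
    D-α-W : ∀ {w} → w ∈W → D (α w) ≡ 0#
    D-α-W {w} w∈W = begin
      G (α w + y) - (G (α w) + G y)  ≡⟨ cong₂ (λ a b → a - (b + G y)) (G-translate w∈W y) (G-α-W w∈W) ⟩
      G y - (0# + G y)               ≡⟨ cong (λ b → G y - b) (+-identityˡ (G y)) ⟩
      G y - G y                      ≡⟨ -‿inverseʳ (G y) ⟩
      0#                             ∎
      where open ≡-Reasoning
    D-roots : All (λ r → D r ≡ 0#) (map α Ws)
    D-roots = Allₚ.map⁺ (All.tabulate (D-α-W ∘ to (∈⇔ Ws-enumerates)))

  P-0≢0 : P 0# ≢ 0#
  P-0≢0 = prod-≢0 (Allₚ.map⁺ (All.tabulate (λ w∈W* → α-≢0 (proj₂ (to (∈⇔ W*-enumerates) w∈W*)) ∘ trans (sym (+-identityˡ _)))))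

  P-scale : ∀ {c c′} → c 𝔽.* c′ ≡ 𝔽.1# → ∀ x → P (ι c * x) ≡ ι c ^ length W* * P x
  P-scale {c} cc′≡1 x = begin
    prod (map (λ w → ι c * x + α w) W*)          ≡⟨ prod-map-↭ (λ w → ι c * x + α w) (c ·_) (scale-↭ cc′≡1) ⟨
    prod (map (λ w → ι c * x + α (c · w)) W*)    ≡⟨ cong prod (map-cong factor-out W*) ⟩
    prod (map (λ w → ι c * (x + α w)) W*)        ≡⟨ prod-map-*ˡ (ι c) (λ w → x + α w) W* ⟩
    ι c ^ length W* * P x                        ∎
    where
    open ≡-Reasoning
    factor-out : ∀ w → ι c * x + α (c · w) ≡ ι c * (x + α w)
    factor-out w = trans (cong (ι c * x +_) (α-homogeneous c w)) (sym (distribˡ (ι c) x (α w)))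

  G-homogeneous : ∀ c x → G (ι c * x) ≡ ι c * G x
  G-homogeneous c x with c 𝔽.≟ 𝔽.0#
  ... | yes refl = begin
    G (ι 𝔽.0# * x)   ≡⟨ cong G (trans (cong (_* x) ι-0) (zeroˡ x)) ⟩
    G 0#             ≡⟨ G-0 ⟩
    0#               ≡⟨ trans (cong (_* G x) ι-0) (zeroˡ (G x)) ⟨
    ι 𝔽.0# * G x     ∎
    where open ≡-Reasoning
  ... | no c≢0 with 𝔽.inverse c c≢0
  ... | c′ , cc′≡1 = begin
    G (ι c * x)                             ≡⟨ G≡x*P (ι c * x) ⟩
    ι c * x * P (ι c * x)                   ≡⟨ cong (ι c * x *_) (P-scale cc′≡1 x) ⟩
    ι c * x * (ι c ^ length W* * P x)       ≡⟨ cong (λ a → ι c * x * (a * P x)) ιc^|W*|≡1 ⟩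
    ι c * x * (1# * P x)                    ≡⟨ cong (ι c * x *_) (*-identityˡ (P x)) ⟩
    ι c * x * P x                           ≡⟨ *-assoc (ι c) x (P x) ⟩
    ι c * (x * P x)                         ≡⟨ cong (ι c *_) (G≡x*P x) ⟨
    ι c * G x                               ∎
    where
    open ≡-Reasoning
    ιc^|W*|≡1 : ι c ^ length W* ≡ 1#
    ιc^|W*|≡1 = x*y≡y⇒x≡1 P-0≢0 (trans (sym (P-scale cc′≡1 0#)) (cong P (zeroʳ (ι c))))

  -- The factor function of catalan is where-bound, so it can only be named through unification.
  catalan-as-prod : (Φ : V → ℕ) → Σ (V → Carrier) λ factor → catalan K E α Φ ≡ prod (map factor L)
  catalan-as-prod Φ = _ , refl

  catalanFactor : (V → ℕ) → V → Carrier
  catalanFactor Φ = proj₁ (catalan-as-prod Φ)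

  catalanFactor-coset : ∀ {v} → ¬ v ∈W → ∀ u → catalanFactor (𝟏coset W v) u ≡ (if does (dec (u ⊖ v)) then α u else 1#)
  catalanFactor-coset {v} v∉W u with u ≟V 𝟎
  ... | yes refl with dec (𝟎 ⊖ v)
  ...   | yes 𝟎-v∈W = contradiction (subst _∈W (⊖-⊖-cancel 𝟎 v) (⊖-closed zero∈ 𝟎-v∈W)) v∉W
  ...   | no _      = refl
  catalanFactor-coset {v} v∉W u | no _ with dec (u ⊖ v)
  ...   | yes _ = *-identityʳ (α u)
  ...   | no _  = refl

  cosetMap≡G∘α : ∀ v → cosetMap K E α W v ≡ G (α v)
  cosetMap≡G∘α v with dec v
  ... | yes v∈W = sym (G-α-W v∈W)
  ... | no v∉W  = begin
    prod (map (catalanFactor (𝟏coset W v)) L)                ≡⟨ cong prod (map-cong (catalanFactor-coset v∉W) L) ⟩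
    prod (map (λ u → if does (dec (u ⊖ v)) then α u else 1#) L) ≡⟨ prod-map-filter (λ u → dec (u ⊖ v)) α L ⟩
    prod (map α (filter (λ u → dec (u ⊖ v)) L))               ≡⟨ prod-map-↭ α (_⊕ v) coset-↭ ⟨
    prod (map (α ∘ (_⊕ v)) Ws)                                ≡⟨ cong prod (map-cong (λ w → trans (α-additive w v) (+-comm (α w) (α v))) Ws) ⟩
    G (α v)                                                   ∎
    where
    open ≡-Reasoning
    coset-↭ : map (_⊕ v) Ws ↭ filter (λ u → dec (u ⊖ v)) L
    coset-↭ = enumerates-↭ (coset-enumerates v) (enumerates-filter (allVecs-complete n) (allVecs-unique n) _)

  cosetMap-linear : IsLinear K E (cosetMap K E α W)
  cosetMap-linear = additive , homogeneous
    where
    open ≡-Reasoning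
    additive : ∀ u v → cosetMap K E α W (u ⊕ v) ≡ cosetMap K E α W u + cosetMap K E α W v
    additive u v = begin
      cosetMap K E α W (u ⊕ v)   ≡⟨ cosetMap≡G∘α (u ⊕ v) ⟩
      G (α (u ⊕ v))              ≡⟨ cong G (α-additive u v) ⟩
      G (α u + α v)              ≡⟨ G-additive (α u) (α v) ⟩
      G (α u) + G (α v)          ≡⟨ cong₂ _+_ (cosetMap≡G∘α u) (cosetMap≡G∘α v) ⟨
      cosetMap K E α W u + cosetMap K E α W v ∎
    homogeneous : ∀ c v → cosetMap K E α W (c · v) ≡ ι c * cosetMap K E α W v
    homogeneous c v = begin
      cosetMap K E α W (c · v)   ≡⟨ cosetMap≡G∘α (c · v) ⟩
      G (α (c · v))              ≡⟨ cong G (α-homogeneous c v) ⟩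
      G (ι c * α v)              ≡⟨ G-homogeneous c (α v) ⟩
      ι c * G (α v)              ≡⟨ cong (ι c *_) (cosetMap≡G∘α v) ⟨
      ι c * cosetMap K E α W v   ∎

proposition3p1 : (F : FiniteField) (n : ℕ) (K : Field) (E : Extension F K)
    → let open VectorSpace F n in
    (α : V → Field.Carrier K) → IsInjective K E α → IsLinear K E α
    → (W : Subspace) → IsLinear K E (cosetMap K E α W)
proposition3p1 F n K E α α-injective α-linear W = SubspacePolynomial.cosetMap-linear F n K E α α-injective α-linear W
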